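{- Let $H$ be a loopless multigraph of minimum degree at least $3$ in which every pair of vertices is joined by at most $2$ edges. Let $G$ be the graph obtained from $H$ by replacing each simple edge $xy$ by a path $x\text{ -- }a\text{ -- }y$ with a new vertex $a$, and each pair of parallel edges between $x$ and $y$ by two internally disjoint paths $x\text{ -- }a\text{ -- }y$ and $x\text{ -- }b\text{ -- }c\text{ -- }y$ with new vertices $a,b,c$. Then $\operatorname{fdom}(G)\ge 5/2$.
   Context: For integers $0<q\le p$, a dominating $(p:q)$-colouring of a graph $G$ is a map $\phi\colon V(G)\to\binom{[p]}{q}$ with $\bigcup_{u\in N[v]}\phi(u)=[p]$ for every vertex $v$ ($N[v]$ the closed neighbourhood); $\operatorname{fdom}(G)$ is the maximum of $p/q$ over such colourings. -}

module Defs where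

open import Data.Nat using (ℕ; _≤_; _<_; _*_)
open import Data.Fin using (Fin) renaming (_<_ to _<ᶠ_)
open import Data.Fin.Subset using (Subset; _∈_; ∣_∣)
open import Data.List using (map; allFin)
open import Data.Nat.ListAction using (sum)
open import Data.Product using (Σ; ∃; _×_)
open import Data.Sum using (_⊎_)
open import Relation.Binary.PropositionalEquality using (_≡_)

-- A finite multigraph H on vertex set Fin n is given by its edge-multiplicity
-- function m x y = number of edges between x and y.
MultiGraph : ℕ → Set
MultiGraph n = Fin n → Fin n → ℕ

degree : ∀ {n} → MultiGraph n → Fin n → ℕ
degree {n} m x = sum (map (m x) (allFin n))

record Admissible {n : ℕ} (m : MultiGraph n) : Set where
  field
    symmetric : ∀ x y → m x y ≡ m y x
    loopless  : ∀ x → m x x ≡ 0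
    mult≤2    : ∀ x y → m x y ≤ 2
    mindeg    : ∀ x → 3 ≤ degree m x

module _ {n : ℕ} (m : MultiGraph n) where

  -- Vertices of G: the original vertices of H; for each pair x < y joined by
  -- at least one edge, a vertex a (path x-a-y); for each pair x < y joined by
  -- two parallel edges, vertices b, c (path x-b-c-y).
  data GV : Set where
    orig : Fin n → GV
    subA : (x y : Fin n) → x <ᶠ y → 1 ≤ m x y → GV
    subB : (x y : Fin n) → x <ᶠ y → 2 ≤ m x y → GV
    subC : (x y : Fin n) → x <ᶠ y → 2 ≤ m x y → GV

  data Arc : GV → GV → Set where
    a-x : ∀ x y p q → Arc (orig x) (subA x y p q)
    a-y : ∀ x y p q → Arc (orig y) (subA x y p q)
    b-x : ∀ x y p q → Arc (orig x) (subB x y p q)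
    c-y : ∀ x y p q → Arc (orig y) (subC x y p q)
    b-c : ∀ x y p q p′ q′ → Arc (subB x y p q) (subC x y p′ q′)

  Adj : GV → GV → Set
  Adj u v = Arc u v ⊎ Arc v u

  InClosedNbhd : GV → GV → Set
  InClosedNbhd v u = u ≡ v ⊎ Adj v u

  record DomColouring (p q : ℕ) : Set where
    field
      φ        : GV → Subset p
      size     : ∀ v → ∣ φ v ∣ ≡ q
      dominate : ∀ v (c : Fin p) → ∃ λ u → InClosedNbhd v u × c ∈ φ u

  FdomAtLeast5/2 : Set
  FdomAtLeast5/2 = ∃ λ p → ∃ λ q → 0 < q × q ≤ p × 5 * q ≤ 2 * p × DomColouring p q

-- It suffices to find p dominating sets of G such that every vertex lies in at most q = 2p/5 of them:
-- the colour classes are then padded to exactly q colours. The p = 10^(1+n) sets D(w) are indexed by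
-- words w = g ∷ v over {0,…,9}: a global digit g and a digit v x for each vertex x of H. A vertex x with
-- a double edge is in D when g < 8 and v x < 5; otherwise x has three distinct simple neighbours
-- d₀ d₁ d₂ and is in D when v x < 4. The subdivision vertex of an edge xy is in D when x, y ∉ D, or when
-- x ∉ D ∋ d₀, d₁, d₂ and v x names y (the only situation in which x is not yet dominated); on a double
-- path x-b-c-y, b is in D when g ≥ 8 or x ∉ D ∋ y, and c when g < 8 and y ∉ D. For fixed g each of these
-- events is covered by at most three products of conditions on distinct, hence independent, digits, and
-- counting words shows that each vertex lies in at most 2/5 of the sets D(w).

module Submission where

open import Data.Bool using (Bool; true; false; not; _∧_; _∨_; if_then_else_)
open import Data.Bool.Properties using (∧-comm; ∨-comm; ∨-zeroʳ; ∨-distribˡ-∧)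
open import Data.Fin using (Fin; zero; suc; toℕ; remQuot; combine; punchIn; quotient; splitAt)
open import Data.Fin.Properties
  using (_≟_; any?; <-cmp; suc-injective; combine-remQuot; punchIn-injective; punchInᵢ≢i)
open import Data.Fin.Subset using (Subset; ∣_∣; _⊆_; _∈_; inside; outside; ⊤)
open import Data.Fin.Subset.Properties using (⊆⊤; ∣⊤∣≡n; s⊆s)
open import Data.List using (List; []; _∷_; length; map; allFin)
import Data.List as List
open import Data.List.Properties using (map-tabulate)
open import Data.List.Relation.Unary.All using (All; []; _∷_)
open import Data.List.Relation.Unary.AllPairs using ([]; _∷_)
open import Data.List.Relation.Unary.Unique.Propositional using (Unique)
open import Data.Nat using (ℕ; zero; suc; _+_; _*_; _^_; _≤_; _<ᵇ_; z≤n; s≤s; s≤s⁻¹; _≤?_; NonZero)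
open import Data.Nat.ListAction using (product) renaming (sum to sumᴸ)
open import Data.Nat.Properties
  using ( ≤-refl; ≤-reflexive; ≤-trans; <⇒≤; ≤-antisym; ≰⇒>; ≤∧≢⇒<; ≤ᵇ⇒≤; module ≤-Reasoning
        ; +-mono-≤; *-assoc; *-comm; *-identityˡ; *-identityʳ; *-distribʳ-+; *-monoˡ-≤; *-monoʳ-<
        ; *-cancelʳ-≤; ^-distribˡ-+-*; m^n≢0; m^n>0; +-*-semiring; *-1-commutativeMonoid )
  renaming (_≟_ to _≟ℕ_)
open import Data.Nat.Tactic.RingSolver using (solve-∀)
open import Data.Product using (Σ; ∃; _×_; _,_; proj₁; proj₂)
open import Data.Sum using (_⊎_; inj₁; inj₂; [_,_]′)
open import Data.Vec using (Vec; []; _∷_; head; tail; lookup; concat; tabulate; _++_)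
open import Data.Vec.Functional using (updateAt; removeAt)
open import Data.Vec.Functional.Properties using (updateAt-updates; updateAt-minimal)
open import Data.Vec.Properties using (lookup-concat; lookup∘tabulate; lookup⇒[]=)
open import Function using (_∘_; _$_; id; const; case_of_)
open import Function.Definitions using (Injective)
open import Relation.Binary.Definitions using (tri<; tri≈; tri>)
open import Relation.Binary.PropositionalEquality
open import Relation.Nullary using (Dec; yes; no; does; contradiction)
open import Relation.Nullary.Decidable using (dec-true; dec-false)

open import Defs

open import Algebra.Properties.CommutativeMonoid.Sum *-1-commutativeMonoid
  using () renaming (sum to ∏; sum-cong-≗ to ∏-cong-≗; sum-remove to ∏-remove)
open import Algebra.Properties.Semiring.Sum +-*-semiring
  using (sum; sum-syntax; sum-cong-≗; ∑-distrib-+; *-distribʳ-sum; sum-replicate-zero)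

sum-mono : ∀ {n} {f g : Fin n → ℕ} → (∀ i → f i ≤ g i) → sum f ≤ sum g
sum-mono {zero}  f≤g = z≤n
sum-mono {suc n} f≤g = +-mono-≤ (f≤g zero) (sum-mono (f≤g ∘ suc))

∏-const : ∀ N k → ∏ {N} (const k) ≡ k ^ N
∏-const zero    k = refl
∏-const (suc N) k = cong (k *_) (∏-const N k)

∏-updateAt : ∀ {A : Set} {N} (g : A → ℕ) (S : Fin N → A) x a →
             ∏ (g ∘ updateAt S x (const a)) * g (S x) ≡ g a * ∏ (g ∘ S)
∏-updateAt {N = suc N} g S x a = begin
  ∏ (g ∘ S′) * g (S x)                       ≡⟨ cong (_* g (S x)) (∏-remove {i = x} (g ∘ S′)) ⟩
  g (S′ x) * ∏ (removeAt (g ∘ S′) x) * g (S x)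
    ≡⟨ cong₂ (λ a b → a * b * g (S x)) (cong g (updateAt-updates x S)) (∏-cong-≗ untouched) ⟩
  g a * ∏ (removeAt (g ∘ S) x) * g (S x)     ≡⟨ *-assoc (g a) _ _ ⟩
  g a * (∏ (removeAt (g ∘ S) x) * g (S x))   ≡⟨ cong (g a *_) (*-comm _ (g (S x))) ⟩
  g a * (g (S x) * ∏ (removeAt (g ∘ S) x))   ≡⟨ cong (g a *_) (∏-remove {i = x} (g ∘ S)) ⟨
  g a * ∏ (g ∘ S)                            ∎
  where
  open ≡-Reasoning
  S′ = updateAt S x (const a)
  untouched : removeAt (g ∘ S′) x ≗ removeAt (g ∘ S) x
  untouched j = cong g (updateAt-minimal (punchIn x j) x S (punchInᵢ≢i x j))

∣p++q∣≡∣p∣+∣q∣ : ∀ {m n} (p : Subset m) (q : Subset n) → ∣ p ++ q ∣ ≡ ∣ p ∣ + ∣ q ∣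
∣p++q∣≡∣p∣+∣q∣ []            q = refl
∣p++q∣≡∣p∣+∣q∣ (inside  ∷ p) q = cong suc (∣p++q∣≡∣p∣+∣q∣ p q)
∣p++q∣≡∣p∣+∣q∣ (outside ∷ p) q = ∣p++q∣≡∣p∣+∣q∣ p q

∣concat-tabulate∣ : ∀ {m n} (f : Fin n → Subset m) → ∣ concat (tabulate f) ∣ ≡ ∑[ i < n ] ∣ f i ∣
∣concat-tabulate∣ {n = zero}  f = refl
∣concat-tabulate∣ {n = suc n} f =
  trans (∣p++q∣≡∣p∣+∣q∣ (f zero) _) (cong (∣ f zero ∣ +_) (∣concat-tabulate∣ (f ∘ suc)))

superset-of-size : ∀ {n} (p : Subset n) {s} → ∣ p ∣ ≤ s → s ≤ n → ∃ λ q → p ⊆ q × ∣ q ∣ ≡ s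
superset-of-size []            {zero}  _         _         = [] , id , refl
superset-of-size (inside ∷ p)  {suc s} (s≤s p≤s) (s≤s s≤n) with superset-of-size p p≤s s≤n
... | q , p⊆q , ∣q∣≡s = inside ∷ q , s⊆s p⊆q , cong suc ∣q∣≡s
superset-of-size {suc n} (outside ∷ p) {s} p≤s s≤1+n with s ≤? n
... | yes s≤n with superset-of-size p p≤s s≤n
...   | q , p⊆q , ∣q∣≡s = outside ∷ q , s⊆s p⊆q , ∣q∣≡s
superset-of-size {suc n} (outside ∷ p) {s} p≤s s≤1+n | no s≰n =
  ⊤ , ⊆⊤ , trans (∣⊤∣≡n (suc n)) (≤-antisym (≰⇒> s≰n) s≤1+n)

support-injection : ∀ {n r} (f : Fin n → ℕ) → (∀ i → f i ≤ 1) → r ≤ ∑[ i < n ] f i →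
                    Σ (Fin r → Fin n) λ d → Injective _≡_ _≡_ d × (∀ i → 1 ≤ f (d i))
support-injection {zero} {zero} f f≤1 r≤∑ = (λ ()) , (λ {}) , (λ ())
support-injection {suc n} {r} f f≤1 r≤∑ with f zero in f₀ | f≤1 zero
... | zero | _ with support-injection (f ∘ suc) (f≤1 ∘ suc) r≤∑
...   | d , d-inj , d-supp = suc ∘ d , d-inj ∘ suc-injective , d-supp
support-injection {suc n} {zero} f f≤1 r≤∑ | suc zero | _ = (λ ()) , (λ {}) , (λ ())
support-injection {suc n} {suc r} f f≤1 r≤∑ | suc zero | _
  with support-injection (f ∘ suc) (f≤1 ∘ suc) (s≤s⁻¹ r≤∑)
...   | d , d-inj , d-supp = d′ , d′-inj , d′-supp
  where
  d′ : Fin (suc r) → Fin (suc n)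
  d′ zero    = zero
  d′ (suc i) = suc (d i)
  d′-inj : Injective _≡_ _≡_ d′
  d′-inj {zero}  {zero}  _ = refl
  d′-inj {suc i} {suc j} e = cong suc (d-inj (suc-injective e))
  d′-supp : ∀ i → 1 ≤ f (d′ i)
  d′-supp zero    = ≤-reflexive (sym f₀)
  d′-supp (suc i) = d-supp i
support-injection {suc n} f f≤1 r≤∑ | suc (suc _) | s≤s ()

sum-tabulate : ∀ {n} (f : Fin n → ℕ) → sumᴸ (List.tabulate f) ≡ ∑[ i < n ] f i
sum-tabulate {zero}  f = refl
sum-tabulate {suc n} f = cong (f zero +_) (sum-tabulate (f ∘ suc))

sum-allFin : ∀ {n} (f : Fin n → ℕ) → sumᴸ (List.map f (allFin n)) ≡ ∑[ i < n ] f i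
sum-allFin f = trans (cong sumᴸ (map-tabulate id f)) (sum-tabulate f)

∧-true⁻ : ∀ a {b} → a ∧ b ≡ true → a ≡ true × b ≡ true
∧-true⁻ true b≡true = refl , b≡true

module Counting (k : ℕ) where

  Word : ℕ → Set
  Word = Vec (Fin k)

  Event : ℕ → Set
  Event N = Word N → Bool

  count : ∀ {N} → Event N → ℕ
  count {zero}  E = if E [] then 1 else 0
  count {suc N} E = ∑[ d < k ] count (λ w → E (d ∷ w))

  card : (Fin k → Bool) → ℕ
  card P = count {1} λ w → P (lookup w zero)

  count-∅ : ∀ {N} {E : Event N} → (∀ w → E w ≡ false) → count E ≡ 0
  count-∅ {zero}  {E} E≡false rewrite E≡false [] = refl
  count-∅ {suc N} {E} E≡false =
    trans (sum-cong-≗ λ d → count-∅ λ w → E≡false (d ∷ w)) (sum-replicate-zero k)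

  count-∨ : ∀ {N} (E F : Event N) → count (λ w → E w ∨ F w) ≤ count E + count F
  count-∨ {zero} E F with E [] | F []
  ... | true  | _     = s≤s z≤n
  ... | false | true  = ≤-refl
  ... | false | false = z≤n
  count-∨ {suc N} E F = begin
    ∑[ d < k ] count (λ w → E (d ∷ w) ∨ F (d ∷ w))
      ≤⟨ sum-mono {k} (λ d → count-∨ (E ∘ (d ∷_)) (F ∘ (d ∷_))) ⟩
    ∑[ d < k ] (count (λ w → E (d ∷ w)) + count (λ w → F (d ∷ w))) ≡⟨ ∑-distrib-+ {k} _ _ ⟩
    count E + count F                                          ∎
    where open ≤-Reasoning

  Box : ∀ {N} → (Fin N → Fin k → Bool) → Word N → Set
  Box S w = ∀ i → S i (lookup w i) ≡ true

  count-box : ∀ {N} (S : Fin N → Fin k → Bool) {E : Event N} →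
              (∀ w → E w ≡ true → Box S w) → count E ≤ ∏ (card ∘ S)
  count-box {zero}  S {E} E⊆S with E []
  ... | true  = ≤-refl
  ... | false = z≤n
  count-box {suc N} S {E} E⊆S = begin
    ∑[ d < k ] count (λ w → E (d ∷ w))                            ≤⟨ sum-mono {k} slice ⟩
    ∑[ d < k ] ((if S zero d then 1 else 0) * ∏ (card ∘ S ∘ suc)) ≡⟨ *-distribʳ-sum {k} _ _ ⟨
    card (S zero) * ∏ (card ∘ S ∘ suc)                            ∎
    where
    open ≤-Reasoning
    slice : ∀ d → count (λ w → E (d ∷ w)) ≤ (if S zero d then 1 else 0) * ∏ (card ∘ S ∘ suc)
    slice d with S zero d in eq
    ... | true  = ≤-trans (count-box (S ∘ suc) λ w e i → E⊆S (d ∷ w) e (suc i))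
                          (≤-reflexive (sym (*-identityˡ _)))
    ... | false = ≤-reflexive (count-∅ excluded)
      where
      excluded : ∀ w → E (d ∷ w) ≡ false
      excluded w with E (d ∷ w) in e
      ... | true  = case trans (sym (E⊆S (d ∷ w) e zero)) eq of λ ()
      ... | false = refl

  Constraint : ℕ → Set
  Constraint N = Fin N × (Fin k → Bool)

  Satisfies : ∀ {N} → List (Constraint N) → Word N → Set
  Satisfies cs w = All (λ (x , P) → P (lookup w x) ≡ true) cs

  weight : ∀ {N} → List (Constraint N) → ℕ
  weight cs = product (map (card ∘ proj₂) cs)

  constrain : ∀ {N} → List (Constraint N) → Fin N → Fin k → Bool
  constrain []            = λ _ _ → true
  constrain ((x , P) ∷ cs) = updateAt (constrain cs) x (const P)

  satisfies⇒box : ∀ {N} (cs : List (Constraint N)) w → Satisfies cs w → Box (constrain cs) w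
  satisfies⇒box []             w []       i = refl
  satisfies⇒box ((x , P) ∷ cs) w (Px ∷ s) i with i ≟ x
  ... | yes refl = trans (cong (λ Q → Q (lookup w i)) (updateAt-updates i (constrain cs))) Px
  ... | no  i≢x  = trans (cong (λ Q → Q (lookup w i)) (updateAt-minimal i x (constrain cs) i≢x))
                         (satisfies⇒box cs w s i)

  constrain-free : ∀ {N} (cs : List (Constraint N)) {x} → All (x ≢_) (map proj₁ cs) →
                   constrain cs x ≡ const true
  constrain-free []             []         = refl
  constrain-free ((y , P) ∷ cs) (x≢y ∷ x∉) =
    trans (updateAt-minimal _ y (constrain cs) x≢y) (constrain-free cs x∉)

  card-true : card (const true) ≡ k
  card-true = go k
    where
    go : ∀ n → sum {n} (const 1) ≡ n
    go zero    = refl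
    go (suc n) = cong suc (go n)

  ∏-card-constrain : ∀ {N} (cs : List (Constraint N)) → Unique (map proj₁ cs) →
                     ∏ (card ∘ constrain cs) * k ^ length cs ≡ weight cs * k ^ N
  ∏-card-constrain {N} [] [] = begin
    ∏ {N} (const (card (const true))) * 1 ≡⟨ *-identityʳ _ ⟩
    ∏ {N} (const (card (const true)))     ≡⟨ cong (λ c → ∏ {N} (const c)) card-true ⟩
    ∏ {N} (const k)                       ≡⟨ ∏-const N k ⟩
    k ^ N                                 ≡⟨ *-identityˡ _ ⟨
    1 * k ^ N                             ∎
    where open ≡-Reasoning
  ∏-card-constrain {N} ((x , P) ∷ cs) (x∉ ∷ unique) = begin
    ∏ (card ∘ S′) * (k * k ^ length cs)                 ≡⟨ *-assoc (∏ (card ∘ S′)) k _ ⟨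
    ∏ (card ∘ S′) * k * k ^ length cs                   ≡⟨ cong (λ c → ∏ (card ∘ S′) * c * _) free ⟨
    ∏ (card ∘ S′) * card (constrain cs x) * k ^ length cs
      ≡⟨ cong (_* k ^ length cs) (∏-updateAt card (constrain cs) x P) ⟩
    card P * ∏ (card ∘ constrain cs) * k ^ length cs    ≡⟨ *-assoc (card P) _ _ ⟩
    card P * (∏ (card ∘ constrain cs) * k ^ length cs)  ≡⟨ cong (card P *_) (∏-card-constrain cs unique) ⟩
    card P * (weight cs * k ^ N)                        ≡⟨ *-assoc (card P) _ _ ⟨
    card P * weight cs * k ^ N                          ∎
    where
    open ≡-Reasoning
    S′ = constrain ((x , P) ∷ cs)
    free : card (constrain cs x) ≡ k
    free = trans (cong card (constrain-free cs x∉)) card-true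

  -- Pr≤ E c r : E holds on at most a fraction c / k ^ r of all words.
  record Pr≤ {N} (E : Event N) (c r : ℕ) : Set where
    constructor pr≤
    field bound : count E * k ^ r ≤ c * k ^ N

  Pr≤-cylinder : ∀ {N} (cs : List (Constraint N)) → Unique (map proj₁ cs) → {E : Event N} →
                 (∀ w → E w ≡ true → Satisfies cs w) → Pr≤ E (weight cs) (length cs)
  Pr≤-cylinder {N} cs unique {E} E⊆cs = pr≤ $ begin
    count E * k ^ length cs                  ≤⟨ *-monoˡ-≤ _ (count-box (constrain cs) E⊆box) ⟩
    ∏ (card ∘ constrain cs) * k ^ length cs  ≡⟨ ∏-card-constrain cs unique ⟩
    weight cs * k ^ N                        ∎
    where
    open ≤-Reasoning
    E⊆box : ∀ w → E w ≡ true → Box (constrain cs) w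
    E⊆box w e = satisfies⇒box cs w (E⊆cs w e)

  Pr≤-weaken : ∀ {N} {E : Event N} {c c′ r} → c ≤ c′ → Pr≤ E c r → Pr≤ E c′ r
  Pr≤-weaken c≤c′ (pr≤ p) = pr≤ (≤-trans p (*-monoˡ-≤ _ c≤c′))

  Pr≤-∅ : ∀ {N} {E : Event N} {c r} → (∀ w → E w ≡ false) → Pr≤ E c r
  Pr≤-∅ E≡false = pr≤ (≤-trans (≤-reflexive (cong (_* _) (count-∅ E≡false))) z≤n)

  Pr≤-∨ : ∀ {N} {E F : Event N} {a b r} → Pr≤ E a r → Pr≤ F b r → Pr≤ (λ w → E w ∨ F w) (a + b) r
  Pr≤-∨ {N} {E} {F} {a} {b} {r} (pr≤ pE) (pr≤ pF) = pr≤ $ begin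
    count (λ w → E w ∨ F w) * k ^ r  ≤⟨ *-monoˡ-≤ _ (count-∨ E F) ⟩
    (count E + count F) * k ^ r      ≡⟨ *-distribʳ-+ (k ^ r) (count E) _ ⟩
    count E * k ^ r + count F * k ^ r ≤⟨ +-mono-≤ pE pF ⟩
    a * k ^ N + b * k ^ N            ≡⟨ *-distribʳ-+ (k ^ N) a b ⟨
    (a + b) * k ^ N                  ∎
    where open ≤-Reasoning

  Pr≤-refine : ∀ {N} {E : Event N} {c r} s → Pr≤ E c r → Pr≤ E (c * k ^ s) (s + r)
  Pr≤-refine {N} {E} {c} {r} s (pr≤ p) = pr≤ $ begin
    count E * k ^ (s + r)        ≡⟨ cong (count E *_) (trans (^-distribˡ-+-* k s r) (*-comm (k ^ s) _)) ⟩
    count E * (k ^ r * k ^ s)    ≡⟨ *-assoc (count E) _ _ ⟨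
    count E * k ^ r * k ^ s      ≤⟨ *-monoˡ-≤ _ p ⟩
    c * k ^ N * k ^ s            ≡⟨ *-assoc c _ _ ⟩
    c * (k ^ N * k ^ s)          ≡⟨ cong (c *_) (*-comm (k ^ N) _) ⟩
    c * (k ^ s * k ^ N)          ≡⟨ *-assoc c _ _ ⟨
    c * k ^ s * k ^ N            ∎
    where open ≤-Reasoning

  Pr≤-slices : ∀ {N} {E : Event (suc N)} {r} (c : Fin k → ℕ) →
               (∀ d → Pr≤ (λ w → E (d ∷ w)) (c d) r) → Pr≤ E (∑[ d < k ] c d) (suc r)
  Pr≤-slices {N} {E} {r} c p = pr≤ $ begin
    count E * (k * k ^ r)                               ≡⟨ cong (count E *_) (*-comm k _) ⟩
    count E * (k ^ r * k)                               ≡⟨ *-assoc (count E) _ _ ⟨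
    count E * k ^ r * k                                 ≡⟨ cong (_* k) (*-distribʳ-sum {k} (k ^ r) _) ⟩
    (∑[ d < k ] (count (λ w → E (d ∷ w)) * k ^ r)) * k  ≤⟨ *-monoˡ-≤ k (sum-mono {k} (Pr≤.bound ∘ p)) ⟩
    (∑[ d < k ] (c d * k ^ N)) * k                      ≡⟨ cong (_* k) (*-distribʳ-sum {k} (k ^ N) c) ⟨
    (∑[ d < k ] c d) * k ^ N * k                        ≡⟨ *-assoc (∑[ d < k ] c d) _ _ ⟩
    (∑[ d < k ] c d) * (k ^ N * k)                      ≡⟨ cong ((∑[ d < k ] c d) *_) (*-comm (k ^ N) k) ⟩
    (∑[ d < k ] c d) * (k * k ^ N)                      ∎
    where open ≤-Reasoning

  count≤ : ∀ {N} {E : Event (suc N)} {c r} ⦃ _ : NonZero k ⦄ →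
           Pr≤ E (c * k ^ r) (suc r) → count E ≤ c * k ^ N
  count≤ {N} {E} {c} {r} (pr≤ p) = *-cancelʳ-≤ (count E) (c * k ^ N) (k ^ suc r) ⦃ m^n≢0 k (suc r) ⦄ $ begin
    count E * k ^ suc r          ≤⟨ p ⟩
    c * k ^ r * (k * k ^ N)      ≡⟨ swap c (k ^ r) k (k ^ N) ⟩
    c * k ^ N * k ^ suc r        ∎
    where
    open ≤-Reasoning
    swap : ∀ a b c d → a * b * (c * d) ≡ a * d * (c * b)
    swap = solve-∀

  table : ∀ {N} → Event N → Subset (k ^ N)
  table {zero}  E = E [] ∷ []
  table {suc N} E = concat (tabulate λ d → table (λ w → E (d ∷ w)))

  decode : ∀ {N} → Fin (k ^ N) → Word N
  decode {zero}  _ = []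
  decode {suc N} c = proj₁ (remQuot {k} (k ^ N) c) ∷ decode (proj₂ (remQuot {k} (k ^ N) c))

  lookup-table : ∀ {N} (E : Event N) c → lookup (table E) c ≡ E (decode c)
  lookup-table {zero}  E zero = refl
  lookup-table {suc N} E c = begin
    lookup (table E) c                     ≡⟨ cong (lookup (table E)) (combine-remQuot {k} (k ^ N) c) ⟨
    lookup (table E) (combine d c′)        ≡⟨ lookup-concat (tabulate slice) d c′ ⟩
    lookup (lookup (tabulate slice) d) c′  ≡⟨ cong (λ t → lookup t c′) (lookup∘tabulate slice d) ⟩
    lookup (slice d) c′                    ≡⟨ lookup-table (λ w → E (d ∷ w)) c′ ⟩
    E (d ∷ decode c′)                      ∎
    where
    open ≡-Reasoning
    slice : Fin k → Subset (k ^ N)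
    slice d = table (λ w → E (d ∷ w))
    d = proj₁ (remQuot {k} (k ^ N) c)
    c′ = proj₂ (remQuot {k} (k ^ N) c)

  ∣table∣≡count : ∀ {N} (E : Event N) → ∣ table E ∣ ≡ count E
  ∣table∣≡count {zero}  E with E []
  ... | true  = refl
  ... | false = refl
  ∣table∣≡count {suc N} E =
    trans (∣concat-tabulate∣ λ d → table (λ w → E (d ∷ w)))
          (sum-cong-≗ λ d → ∣table∣≡count (λ w → E (d ∷ w)))

module Construction {n : ℕ} (m : MultiGraph n) (adm : Admissible m) where
  open Admissible adm
  open Counting 10

  adjacent⇒≢ : ∀ {x y} → 1 ≤ m x y → x ≢ y
  adjacent⇒≢ {x} 1≤mxy refl = case subst (1 ≤_) (loopless x) 1≤mxy of λ ()

  data Kind (x : Fin n) : Set where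
    hasDouble   : ∀ y → m x y ≡ 2 → Kind x
    threeSimple : (d : Fin 3 → Fin n) → Injective _≡_ _≡_ d → (∀ i → 1 ≤ m x (d i)) →
                  (∀ y → m x y ≤ 1) → Kind x

  kind : ∀ x → Kind x
  kind x with any? (λ y → m x y ≟ℕ 2)
  ... | yes (y , mxy≡2) = hasDouble y mxy≡2
  ... | no  noDouble    = threeSimple d d-inj d-adj simple
    where
    simple : ∀ y → m x y ≤ 1
    simple y = s≤s⁻¹ (≤∧≢⇒< (mult≤2 x y) λ mxy≡2 → noDouble (y , mxy≡2))
    three = support-injection (m x) simple (subst (3 ≤_) (sum-allFin (m x)) (mindeg x))
    d = proj₁ three
    d-inj = proj₁ (proj₂ three)
    d-adj = proj₂ (proj₂ three)

  data Shape : Set where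
    double simple : Shape

  shape : ∀ {x} → Kind x → Shape
  shape (hasDouble _ _)       = double
  shape (threeSimple _ _ _ _) = simple

  shape-of-double : ∀ {x y} → 2 ≤ m x y → shape (kind x) ≡ double
  shape-of-double {x} {y} 2≤mxy with kind x
  ... | hasDouble _ _          = refl
  ... | threeSimple _ _ _ mx≤1 = case ≤-trans 2≤mxy (mx≤1 y) of λ { (s≤s ()) }

  below : ℕ → Fin 10 → Bool
  below t v = toℕ v <ᵇ t

  -- A simple vertex reads its digit v in pairs: ⌊v/2⌋ ∈ {0,1} puts it into the dominating set, and
  -- ⌊v/2⌋ = 2 + i names the neighbour d i it rescues instead.
  slot : Fin 10 → Fin 2 ⊎ Fin 3
  slot v = splitAt 2 (quotient 2 v)

  selects : (Fin 3 → Bool) → Fin 10 → Bool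
  selects P v = [ const false , P ]′ (slot v)

  chooses : Fin 3 → Fin 10 → Bool
  chooses i = selects λ j → does (j ≟ i)

  inDigit : Shape → Fin 10 → Fin 10 → Bool
  inDigit double g v = below 8 g ∧ below 5 v
  inDigit simple g v = [ const true , const false ]′ (slot v)

  outDigit : Shape → Fin 10 → Fin 10 → Bool
  outDigit s g v = not (inDigit s g v)

  anyIn : Fin 10 → Fin 10 → Bool
  anyIn g v = inDigit double g v ∨ inDigit simple g v

  In : Fin n → Fin 10 → Word n → Bool
  In x g v = inDigit (shape (kind x)) g (lookup v x)

  allIn : (Fin 3 → Fin n) → Fin 10 → Word n → Bool
  allIn d g v = In (d zero) g v ∧ (In (d (suc zero)) g v ∧ In (d (suc (suc zero))) g v)

  rescue : ∀ x → Kind x → Fin n → Fin 10 → Word n → Bool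
  rescue x (hasDouble _ _)       y g v = false
  rescue x (threeSimple d _ _ _) y g v = selects (λ i → does (d i ≟ y)) (lookup v x) ∧ allIn d g v

  Rescue : Fin n → Fin n → Fin 10 → Word n → Bool
  Rescue x = rescue x (kind x)

  InA : Fin n → Fin n → Fin 10 → Word n → Bool
  InA x y g v = (not (In x g v) ∧ not (In y g v)) ∨ (Rescue x y g v ∨ Rescue y x g v)

  member : GV m → Fin 10 → Word n → Bool
  member (orig x)       = In x
  member (subA x y _ _) = InA x y
  member (subB x y _ _) g v = not (below 8 g) ∨ (not (In x g v) ∧ In y g v)
  member (subC x y _ _) g v = below 8 g ∧ not (In y g v)

  Dominated : GV m → Fin 10 → Word n → Set
  Dominated u g v = ∃ λ u′ → InClosedNbhd m u u′ × member u′ g v ≡ true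

  InA-sym : ∀ x y g v → InA x y g v ≡ InA y x g v
  InA-sym x y g v = cong₂ _∨_ (∧-comm (not (In x g v)) _) (∨-comm (Rescue x y g v) _)

  InA-out : ∀ {x y g v} → In x g v ≡ false → In y g v ≡ false → InA x y g v ≡ true
  InA-out x∉ y∉ rewrite x∉ | y∉ = refl

  InA-rescue : ∀ {x y g v} → Rescue x y g v ≡ true → InA x y g v ≡ true
  InA-rescue {x} {y} {g} {v} r rewrite r = ∨-zeroʳ (not (In x g v) ∧ not (In y g v))

  dominated-via-edge : ∀ {x y g v} → 1 ≤ m x y → InA x y g v ≡ true → Dominated (orig x) g v
  dominated-via-edge {x} {y} {g} {v} 1≤mxy e with <-cmp x y
  ... | tri< x<y _ _ = subA x y x<y 1≤mxy , inj₂ (inj₁ (a-x x y x<y 1≤mxy)) , e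
  ... | tri≈ _ x≡y _ = contradiction x≡y (adjacent⇒≢ 1≤mxy)
  ... | tri> _ _ y<x = subA y x y<x 1≤myx , inj₂ (inj₁ (a-y y x y<x 1≤myx)) , trans (InA-sym y x g v) e
    where 1≤myx = subst (1 ≤_) (symmetric x y) 1≤mxy

  In-double-out : ∀ {x y g v} → 2 ≤ m x y → below 8 g ≡ false → In x g v ≡ false
  In-double-out {x} {y} {g} {v} 2≤mxy g≥8 rewrite shape-of-double 2≤mxy | g≥8 = refl

  dominated-double : ∀ {x y g v} → 2 ≤ m x y → In x g v ≡ false → Dominated (orig x) g v
  dominated-double {x} {y} {g} {v} 2≤mxy x∉ with <-cmp x y
  ... | tri≈ _ x≡y _ = contradiction x≡y (adjacent⇒≢ (<⇒≤ 2≤mxy))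
  ... | tri< x<y _ _ with In y g v in y∈
  ...   | true  = subB x y x<y 2≤mxy , inj₂ (inj₁ (b-x x y x<y 2≤mxy)) , b∈
    where
    b∈ : member (subB x y x<y 2≤mxy) g v ≡ true
    b∈ rewrite x∉ | y∈ = ∨-zeroʳ (not (below 8 g))
  ...   | false = dominated-via-edge (<⇒≤ 2≤mxy) (InA-out x∉ y∈)
  dominated-double {x} {y} {g} {v} 2≤mxy x∉ | tri> _ _ y<x with below 8 g in g<8
  ... | true  = subC y x y<x 2≤myx , inj₂ (inj₁ (c-y y x y<x 2≤myx)) , c∈
    where
    2≤myx = subst (2 ≤_) (symmetric x y) 2≤mxy
    c∈ : member (subC y x y<x 2≤myx) g v ≡ true
    c∈ rewrite g<8 | x∉ = refl
  ... | false = dominated-via-edge (<⇒≤ 2≤mxy)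
                  (InA-out x∉ (In-double-out {v = v} (subst (2 ≤_) (symmetric x y) 2≤mxy) g<8))

  dominated-simple : ∀ {x g v} d (d-inj : Injective _≡_ _≡_ d) d-adj (mx≤1 : ∀ y → m x y ≤ 1) →
                     kind x ≡ threeSimple d d-inj d-adj mx≤1 → In x g v ≡ false → Dominated (orig x) g v
  dominated-simple {x} {g} {v} d d-inj d-adj mx≤1 κ x∉
    with In (d zero) g v in d₀∈ | In (d (suc zero)) g v in d₁∈ | In (d (suc (suc zero))) g v in d₂∈
  ... | false | _     | _     = dominated-via-edge (d-adj zero) (InA-out x∉ d₀∈)
  ... | true  | false | _     = dominated-via-edge (d-adj (suc zero)) (InA-out x∉ d₁∈)
  ... | true  | true  | false = dominated-via-edge (d-adj (suc (suc zero))) (InA-out x∉ d₂∈)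
  ... | true  | true  | true  with slot (lookup v x) in σ
  ...   | inj₁ _ = case trans (sym x∉) (trans (cong (λ K → inDigit (shape K) g (lookup v x)) κ)
                                               (cong [ const true , const false ]′ σ)) of λ ()
  ...   | inj₂ i = dominated-via-edge (d-adj i) (InA-rescue fires)
    where
    fires : Rescue x (d i) g v ≡ true
    fires rewrite κ | σ | d₀∈ | d₁∈ | d₂∈ | dec-true (d i ≟ d i) refl = refl

  dominated : ∀ u g v → Dominated u g v
  dominated (orig x) g v with In x g v in x∈
  ... | true  = orig x , inj₁ refl , x∈
  ... | false = dominated-out x∈ (kind x) refl
    where
    dominated-out : In x g v ≡ false → (K : Kind x) → kind x ≡ K → Dominated (orig x) g v
    dominated-out x∉ (hasDouble y mxy≡2)             _ = dominated-double (≤-reflexive (sym mxy≡2)) x∉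
    dominated-out x∉ (threeSimple d d-inj d-adj mx≤1) κ = dominated-simple d d-inj d-adj mx≤1 κ x∉
  dominated (subA x y x<y 1≤mxy) g v with In x g v in x∈ | In y g v in y∈
  ... | true  | _     = orig x , inj₂ (inj₂ (a-x x y x<y 1≤mxy)) , x∈
  ... | false | true  = orig y , inj₂ (inj₂ (a-y x y x<y 1≤mxy)) , y∈
  ... | false | false = subA x y x<y 1≤mxy , inj₁ refl , InA-out x∈ y∈
  dominated (subB x y x<y 2≤mxy) g v with In x g v in x∈ | below 8 g in g<8 | In y g v in y∈
  ... | true  | _     | _     = orig x , inj₂ (inj₂ (b-x x y x<y 2≤mxy)) , x∈
  ... | false | false | _     = subB x y x<y 2≤mxy , inj₁ refl , b∈
    where
    b∈ : member (subB x y x<y 2≤mxy) g v ≡ true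
    b∈ rewrite g<8 = refl
  ... | false | true  | true  = subB x y x<y 2≤mxy , inj₁ refl , b∈
    where
    b∈ : member (subB x y x<y 2≤mxy) g v ≡ true
    b∈ rewrite g<8 | x∈ | y∈ = refl
  ... | false | true  | false = subC x y x<y 2≤mxy , inj₂ (inj₁ (b-c x y x<y 2≤mxy x<y 2≤mxy)) , c∈
    where
    c∈ : member (subC x y x<y 2≤mxy) g v ≡ true
    c∈ rewrite g<8 | y∈ = refl
  dominated (subC x y x<y 2≤mxy) g v with In y g v in y∈ | below 8 g in g<8
  ... | true  | _     = orig y , inj₂ (inj₂ (c-y x y x<y 2≤mxy)) , y∈
  ... | false | true  = subC x y x<y 2≤mxy , inj₁ refl , c∈
    where
    c∈ : member (subC x y x<y 2≤mxy) g v ≡ true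
    c∈ rewrite g<8 | y∈ = refl
  ... | false | false = subB x y x<y 2≤mxy , inj₂ (inj₂ (b-c x y x<y 2≤mxy x<y 2≤mxy)) , b∈
    where
    b∈ : member (subB x y x<y 2≤mxy) g v ≡ true
    b∈ rewrite g<8 = refl

  card-chooses : ∀ i → card (chooses i) ≡ 2
  card-chooses zero             = refl
  card-chooses (suc zero)       = refl
  card-chooses (suc (suc zero)) = refl

  selects-mono : ∀ {P Q : Fin 3 → Bool} v → (∀ i → P i ≡ true → Q i ≡ true) →
                 selects P v ≡ true → selects Q v ≡ true
  selects-mono v P⇒Q with slot v
  ... | inj₂ i = P⇒Q i

  selects-none : ∀ {P : Fin 3 → Bool} v → (∀ i → P i ≡ false) → selects P v ≡ false
  selects-none v P≡false with slot v
  ... | inj₁ _ = refl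
  ... | inj₂ i = P≡false i

  allIn⇒In : ∀ d g v → allIn d g v ≡ true → ∀ j → In (d j) g v ≡ true
  allIn⇒In d g v e = λ { zero → d₀∈ ; (suc zero) → proj₁ d₁₂∈ ; (suc (suc zero)) → proj₂ d₁₂∈ }
    where
    d₀∈ = proj₁ (∧-true⁻ (In (d zero) g v) e)
    d₁₂∈ = ∧-true⁻ (In (d (suc zero)) g v) (proj₂ (∧-true⁻ (In (d zero) g v) e))

  inDigit⇒anyIn : ∀ s g v → inDigit s g v ≡ true → anyIn g v ≡ true
  inDigit⇒anyIn double g v e rewrite e = refl
  inDigit⇒anyIn simple g v e rewrite e = ∨-zeroʳ (inDigit double g v)

  origWeight : Shape → Fin 10 → ℕ
  origWeight s g = card (inDigit s g) * 1 * 1000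

  rescueWeight : Shape → Shape → Fin 10 → ℕ
  rescueWeight double _  g = 0
  rescueWeight simple sy g = 2 * (card (inDigit sy g) * (card (anyIn g) * (card (anyIn g) * 1)))

  subAWeight : Shape → Shape → Fin 10 → ℕ
  subAWeight sx sy g = card (outDigit sx g) * (card (outDigit sy g) * 1) * 100
                     + (rescueWeight sx sy g + rescueWeight sy sx g)

  subBWeight : Shape → Shape → Fin 10 → ℕ
  subBWeight sx sy g = card (λ d → not (below 8 g) ∨ outDigit sx g d)
                     * (card (λ d → not (below 8 g) ∨ inDigit sy g d) * 1) * 100

  subCWeight : Shape → Fin 10 → ℕ
  subCWeight sy g = card (λ d → below 8 g ∧ outDigit sy g d) * 1 * 1000

  origBudget : ∀ s → ∑[ g < 10 ] origWeight s g ≤ 4 * 10 ^ 4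
  origBudget double = ≤ᵇ⇒≤ _ _ _
  origBudget simple = ≤ᵇ⇒≤ _ _ _

  subABudget : ∀ sx sy → ∑[ g < 10 ] subAWeight sx sy g ≤ 4 * 10 ^ 4
  subABudget double double = ≤ᵇ⇒≤ _ _ _
  subABudget double simple = ≤ᵇ⇒≤ _ _ _
  subABudget simple double = ≤ᵇ⇒≤ _ _ _
  subABudget simple simple = ≤ᵇ⇒≤ _ _ _

  subBBudget : ∑[ g < 10 ] subBWeight double double g ≤ 4 * 10 ^ 4
  subBBudget = ≤ᵇ⇒≤ _ _ _

  subCBudget : ∑[ g < 10 ] subCWeight double g ≤ 4 * 10 ^ 4
  subCBudget = ≤ᵇ⇒≤ _ _ _

  Pr≤-rescue : ∀ x (K : Kind x) y g → Pr≤ (rescue x K y g) (rescueWeight (shape K) (shape (kind y)) g) 4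
  Pr≤-rescue x (hasDouble _ _) y g = Pr≤-∅ λ v → refl
  Pr≤-rescue x K@(threeSimple d d-inj d-adj _) y g with any? (λ i → d i ≟ y)
  ... | no  y∉d        =
    Pr≤-∅ λ v → cong (_∧ _) (selects-none (lookup v x) λ i → dec-false (d i ≟ y) (y∉d ∘ (i ,_)))
  ... | yes (i , refl) =
    Pr≤-weaken (≤-reflexive (cong (_* weight neighbours) (card-chooses i)))
               (Pr≤-cylinder cs unique {rescue x K (d i) g} satisfies)
    where
    j₀ = punchIn i zero
    j₁ = punchIn i (suc zero)
    neighbours : List (Constraint n)
    neighbours = (d i , inDigit (shape (kind (d i))) g) ∷ (d j₀ , anyIn g) ∷ (d j₁ , anyIn g) ∷ []
    cs = (x , chooses i) ∷ neighbours
    x∉d : ∀ j → x ≢ d j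
    x∉d j = adjacent⇒≢ (d-adj j)
    unique : Unique (map proj₁ cs)
    unique = (x∉d i ∷ x∉d j₀ ∷ x∉d j₁ ∷ [])
           ∷ ((punchInᵢ≢i i zero ∘ sym ∘ d-inj) ∷ (punchInᵢ≢i i (suc zero) ∘ sym ∘ d-inj) ∷ [])
           ∷ ((λ e → case punchIn-injective i zero (suc zero) (d-inj e) of λ ()) ∷ [])
           ∷ [] ∷ []
    same-index : ∀ j (dj≟di : Dec (d j ≡ d i)) → does dj≟di ≡ true → does (j ≟ i) ≡ true
    same-index j (yes dj≡di) _ = dec-true (j ≟ i) (d-inj dj≡di)
    satisfies : ∀ v → rescue x K (d i) g v ≡ true → Satisfies cs v
    satisfies v e =
      let chosen , ins = ∧-true⁻ (selects (λ j → does (d j ≟ d i)) (lookup v x)) e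
          d∈ = allIn⇒In d g v ins
      in selects-mono (lookup v x) (λ j → same-index j (d j ≟ d i)) chosen
       ∷ d∈ i
       ∷ inDigit⇒anyIn (shape (kind (d j₀))) g (lookup v (d j₀)) (d∈ j₀)
       ∷ inDigit⇒anyIn (shape (kind (d j₁))) g (lookup v (d j₁)) (d∈ j₁)
       ∷ []

  Pr≤-orig : ∀ x g → Pr≤ (member (orig x) g) (origWeight (shape (kind x)) g) 4
  Pr≤-orig x g =
    Pr≤-refine 3 (Pr≤-cylinder ((x , inDigit (shape (kind x)) g) ∷ []) ([] ∷ []) λ v x∈ → x∈ ∷ [])

  Pr≤-subA : ∀ x y x<y 1≤mxy g →
             Pr≤ (member (subA x y x<y 1≤mxy) g) (subAWeight (shape (kind x)) (shape (kind y)) g) 4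
  Pr≤-subA x y _ 1≤mxy g =
    Pr≤-∨ (Pr≤-refine 2 (Pr≤-cylinder cs ((adjacent⇒≢ 1≤mxy ∷ []) ∷ [] ∷ []) bothOut))
          (Pr≤-∨ (Pr≤-rescue x (kind x) y g) (Pr≤-rescue y (kind y) x g))
    where
    cs : List (Constraint n)
    cs = (x , outDigit (shape (kind x)) g) ∷ (y , outDigit (shape (kind y)) g) ∷ []
    bothOut : ∀ v → not (In x g v) ∧ not (In y g v) ≡ true → Satisfies cs v
    bothOut v e = let x∉ , y∉ = ∧-true⁻ (not (In x g v)) e in x∉ ∷ y∉ ∷ []

  Pr≤-subB : ∀ x y x<y 2≤mxy g →
             Pr≤ (member (subB x y x<y 2≤mxy) g) (subBWeight (shape (kind x)) (shape (kind y)) g) 4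
  Pr≤-subB x y _ 2≤mxy g = Pr≤-refine 2 (Pr≤-cylinder cs ((x≢y ∷ []) ∷ [] ∷ []) split)
    where
    x≢y = adjacent⇒≢ (<⇒≤ 2≤mxy)
    cs : List (Constraint n)
    cs = (x , λ d → not (below 8 g) ∨ outDigit (shape (kind x)) g d)
       ∷ (y , λ d → not (below 8 g) ∨ inDigit (shape (kind y)) g d) ∷ []
    split : ∀ v → not (below 8 g) ∨ (not (In x g v) ∧ In y g v) ≡ true → Satisfies cs v
    split v e = let x∉ , y∈ = ∧-true⁻ (not (below 8 g) ∨ not (In x g v))
                                       (trans (sym (∨-distribˡ-∧ (not (below 8 g)) _ _)) e)
                in x∉ ∷ y∈ ∷ []

  Pr≤-subC : ∀ x y x<y 2≤mxy g → Pr≤ (member (subC x y x<y 2≤mxy) g) (subCWeight (shape (kind y)) g) 4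
  Pr≤-subC x y _ _ g =
    Pr≤-refine 3 (Pr≤-cylinder ((y , λ d → below 8 g ∧ outDigit (shape (kind y)) g d) ∷ []) ([] ∷ [])
                               λ v c∈ → c∈ ∷ [])

  memberEvent : GV m → Event (suc n)
  memberEvent u w = member u (head w) (tail w)

  Pr≤-member : ∀ u → Pr≤ (memberEvent u) (4 * 10 ^ 4) 5
  Pr≤-member (orig x) = Pr≤-weaken (origBudget (shape (kind x))) (Pr≤-slices _ (Pr≤-orig x))
  Pr≤-member (subA x y x<y 1≤mxy) =
    Pr≤-weaken (subABudget (shape (kind x)) (shape (kind y))) (Pr≤-slices _ (Pr≤-subA x y x<y 1≤mxy))
  Pr≤-member (subB x y x<y 2≤mxy) = Pr≤-weaken budget (Pr≤-slices _ (Pr≤-subB x y x<y 2≤mxy))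
    where
    budget : ∑[ g < 10 ] subBWeight (shape (kind x)) (shape (kind y)) g ≤ 4 * 10 ^ 4
    budget rewrite shape-of-double 2≤mxy | shape-of-double (subst (2 ≤_) (symmetric x y) 2≤mxy) =
      subBBudget
  Pr≤-member (subC x y x<y 2≤mxy) = Pr≤-weaken budget (Pr≤-slices _ (Pr≤-subC x y x<y 2≤mxy))
    where
    budget : ∑[ g < 10 ] subCWeight (shape (kind y)) g ≤ 4 * 10 ^ 4
    budget rewrite shape-of-double (subst (2 ≤_) (symmetric x y) 2≤mxy) = subCBudget

  colourClass : GV m → Subset (10 ^ suc n)
  colourClass u = table (memberEvent u)

  ∣colourClass∣ : ∀ u → ∣ colourClass u ∣ ≤ 4 * 10 ^ n
  ∣colourClass∣ u =
    ≤-trans (≤-reflexive (∣table∣≡count (memberEvent u))) (count≤ {c = 4} {r = 4} (Pr≤-member u))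

  padded : ∀ u → ∃ λ p → colourClass u ⊆ p × ∣ p ∣ ≡ 4 * 10 ^ n
  padded u = superset-of-size (colourClass u) (∣colourClass∣ u) (*-monoˡ-≤ (10 ^ n) (≤ᵇ⇒≤ 4 10 _))

  dominatingColouring : DomColouring m (10 ^ suc n) (4 * 10 ^ n)
  dominatingColouring = record
    { φ        = proj₁ ∘ padded
    ; size     = proj₂ ∘ proj₂ ∘ padded
    ; dominate = dominate
    }
    where
    dominate : ∀ v c → ∃ λ u → InClosedNbhd m v u × c ∈ proj₁ (padded u)
    dominate v c =
      let w = decode {suc n} c
          u , u∈N[v] , e = dominated v (head w) (tail w)
      in u , u∈N[v] , proj₁ (proj₂ (padded u))
                        (lookup⇒[]= c (colourClass u) (trans (lookup-table (memberEvent u) c) e))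

lemma20 : (n : ℕ) (m : MultiGraph n) → Admissible m → FdomAtLeast5/2 m
lemma20 n m adm =
  10 ^ suc n , 4 * 10 ^ n ,
  *-monoʳ-< 4 (m^n>0 10 n) ,
  *-monoˡ-≤ (10 ^ n) (≤ᵇ⇒≤ 4 10 _) ,
  ≤-reflexive (trans (sym (*-assoc 5 4 (10 ^ n))) (*-assoc 2 10 (10 ^ n))) ,
  Construction.dominatingColouring m adm
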